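{- The formal power series $G(t,x;u,d)=\sum_{n\ge0}A_n(x;u,d)\frac{t^n}{n!}$ satisfies $$G(t,x;u,d)=-(x-x^2)\frac{\partial}{\partial x}G(t,x;u,d)+\Big[1-\big((1+u)x+d\big)t\Big]\frac{\partial}{\partial t}G(t,x;u,d).$$
   Context: A tile is a positive integer $m$ together with a marker that is absent ($m$), an up-arrow ($m\!\uparrow$) or a down-arrow ($m\!\downarrow$). For $n\ge1$ the set $\mathrm{GS}_n$ of generalized permutations of $[n]$ consists of words of tiles, each with an ascent set $\mathrm{asc}(\pi)$, defined recursively. $\mathrm{GS}_1$ contains only the word consisting of the unmarked tile $1$, with $\mathrm{asc}=\emptyset$. For $n\ge2$, $\mathrm{GS}_n$ consists of all words $\pi'$ obtained from some $\pi=\pi_1\cdots\pi_{n-1}\in\mathrm{GS}_{n-1}$ by one of: (i) insert the unmarked tile $n$ into gap $j$, $0\le j\le n-1$, i.e. $\pi'=\pi_1\cdots\pi_j\, n\,\pi_{j+1}\cdots\pi_{n-1}$; if $j=0$ then $\mathrm{asc}(\pi')=\{a+1: a\in\mathrm{asc}(\pi)\}$, and if $1\le j\le n-1$ then $\mathrm{asc}(\pi')=\{a\in\mathrm{asc}(\pi): a<j\}\cup\{j\}\cup\{a+1: a\in\mathrm{asc}(\pi),\ a>j\}$; (ii) insert $n\!\uparrow$ immediately left of $\pi_i$, $1\le i\le n-1$; then $\mathrm{asc}(\pi')=\{a\in\mathrm{asc}(\pi): a<i\}\cup\{i\}\cup\{a+1: a\in\mathrm{asc}(\pi), a\ge i\}$;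 (iii) insert $n\!\downarrow$ immediately left of $\pi_i$, $1\le i\le n-1$; then $\mathrm{asc}(\pi')=\{a\in\mathrm{asc}(\pi): a<i\}\cup\{a+1: a\in\mathrm{asc}(\pi), a\ge i\}$. For $\pi\in\mathrm{GS}_n$ let $\mathrm{nua}(\pi)$, $\mathrm{nda}(\pi)$ be the numbers of up-arrow and down-arrow tiles of $\pi$. Define $A(n,k;u,d)=\sum u^{\mathrm{nua}(\pi)}d^{\mathrm{nda}(\pi)}$ over all $\pi\in\mathrm{GS}_n$ with $|\mathrm{asc}(\pi)|=k$, and for $n\ge1$ let $A_n(x;u,d)=\sum_{k=0}^{n-1}A(n,k;u,d)x^k$; set $A_0(x;u,d)=1$. -}

module Defs where

open import Data.Nat using (ℕ; zero; suc; _<_; _≤_; _<?_; _≤?_; _≟_; _!)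
open import Data.Nat.Properties using (_!≢0)
open import Data.Integer using (+_)
open import Data.Rational using (ℚ; _/_; _+_; _-_; _*_; -_; 0ℚ; 1ℚ)
import Data.Rational as ℚ
open import Data.List using (List; []; _∷_; _++_; map; filter; length; concatMap; upTo)
open import Data.Product using (_×_; _,_; proj₁; proj₂)
open import Data.Bool using (Bool; true; false; _∧_)
open import Relation.Nullary.Decidable using (⌊_⌋; _×-dec_)
open import Relation.Nullary using (¬?)

data Marker : Set where
  none up down : Marker

Tile : Set
Tile = ℕ × Marker

-- a generalized permutation: its word of tiles together with its ascent set
-- (ascent set stored as a list of positions, duplicate-free by construction)
GP : Set
GP = List Tile × List ℕ

word : GP → List Tile
word = proj₁

asc : GP → List ℕ
asc = proj₂

-- insert x into gap j: after the first j letters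
insertAt : {A : Set} → ℕ → A → List A → List A
insertAt zero    x ys       = x ∷ ys
insertAt (suc j) x []       = x ∷ []
insertAt (suc j) x (y ∷ ys) = y ∷ insertAt j x ys

-- rule (i): insert unmarked n into gap j (0 ≤ j ≤ n-1)
ruleI : ℕ → GP → ℕ → GP
ruleI n (w , A) zero    = insertAt zero (n , none) w , map suc A
ruleI n (w , A) (suc j') =
  insertAt j (n , none) w ,
  (filter (λ a → a <? j) A ++ (j ∷ map suc (filter (λ a → j <? a) A)))
  where j = suc j'

-- rule (ii): insert n↑ immediately left of π_i (1 ≤ i ≤ n-1)
ruleII : ℕ → GP → ℕ → GP
ruleII n (w , A) i =
  insertAt (Data.Nat._∸_ i 1) (n , up) w ,
  (filter (λ a → a <? i) A ++ (i ∷ map suc (filter (λ a → i ≤? a) A)))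

-- rule (iii): insert n↓ immediately left of π_i (1 ≤ i ≤ n-1)
ruleIII : ℕ → GP → ℕ → GP
ruleIII n (w , A) i =
  insertAt (Data.Nat._∸_ i 1) (n , down) w ,
  (filter (λ a → a <? i) A ++ map suc (filter (λ a → i ≤? a) A))

-- all children in GS_n of π ∈ GS_{n-1}, where n = suc m
children : ℕ → GP → List GP
children m π =
  map (ruleI (suc m) π) (upTo (suc m))
  ++ map (ruleII (suc m) π) (map suc (upTo m))
  ++ map (ruleIII (suc m) π) (map suc (upTo m))

-- GS n (for n ≥ 1); GS 0 is unused (A_0 = 1 is set separately)
GS : ℕ → List GP
GS zero          = []
GS (suc zero)    = (((1 , none) ∷ []) , []) ∷ []
GS (suc (suc m)) = concatMap (children (suc m)) (GS (suc m))

countUp : List Tile → ℕ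
countUp []               = 0
countUp ((_ , up) ∷ ts)  = suc (countUp ts)
countUp (_ ∷ ts)         = countUp ts

countDown : List Tile → ℕ
countDown []                 = 0
countDown ((_ , down) ∷ ts)  = suc (countDown ts)
countDown (_ ∷ ts)           = countDown ts

nua nda : GP → ℕ
nua π = countUp (word π)
nda π = countDown (word π)

-- A(n,k;u,d) as coefficient data: ACount n k a b = number of π ∈ GS_n with
-- |asc π| = k, nua π = a, nda π = b  (coefficient of x^k u^a d^b in A_n).
-- A_0 = 1.

ACount : ℕ → ℕ → ℕ → ℕ → ℕ
ACount zero zero zero zero = 1
ACount zero _ _ _ = 0
ACount (suc n) k a b =
  length (filter (λ π → (length (asc π) ≟ k) ×-dec ((nua π ≟ a) ×-dec (nda π ≟ b)))
                 (GS (suc n)))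

-- Formal power series in t, x, u, d over ℚ, given by coefficient functions:
-- S n k a b = coefficient of t^n x^k u^a d^b.

FPS : Set
FPS = ℕ → ℕ → ℕ → ℕ → ℚ

G : FPS
G n k a b = _/_ (+ ACount n k a b) (n !) {{n !≢0}}

_⊕_ : FPS → FPS → FPS
(S ⊕ T) n k a b = S n k a b + T n k a b

⊝_ : FPS → FPS
(⊝ S) n k a b = - S n k a b

infixl 6 _⊕_
infix 8 ⊝_

mulT : FPS → FPS
mulT S zero    k a b = 0ℚ
mulT S (suc n) k a b = S n k a b

mulX : FPS → FPS
mulX S n zero    a b = 0ℚ
mulX S n (suc k) a b = S n k a b

mulU : FPS → FPS
mulU S n k zero    b = 0ℚ
mulU S n k (suc a) b = S n k a b

mulD : FPS → FPS
mulD S n k a zero    = 0ℚ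
mulD S n k a (suc b) = S n k a b

∂t : FPS → FPS
∂t S n k a b = (+ suc n) ℚ./ 1 * S (suc n) k a b

∂x : FPS → FPS
∂x S n k a b = (+ suc k) ℚ./ 1 * S n (suc k) a b

RHS : FPS → FPS
RHS S =
  ⊝ (mulX (∂x S) ⊕ ⊝ mulX (mulX (∂x S)))
  ⊕ (∂t S ⊕ ⊝ (mulT (mulX (∂t S)) ⊕ mulT (mulU (mulX (∂t S))) ⊕ mulT (mulD (∂t S))))

module Submission where

-- Writing G = Σ_n A_n t^n/n! with A_n = Σ A(n,k,a,b) x^k u^a d^b, the equation
-- G = −(x − x²)∂G/∂x + [1 − ((1+u)x + d) t] ∂G/∂t says, coefficientwise, that
--   A(n+1,k,a,b) + (k−1)·A(n,k−1,a,b) = (k+1)·A(n,k,a,b) + n·[x^k u^a d^b]((1+u)x + d)A_n.  The key fact,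
--     children-statistics, is that a parent π ∈ GS_M with ℓ ascents, u up- and d down-arrows
--     has ℓ+1 children with the same statistics (rule (i) at gap 0 or at an ascent), M−ℓ with
--     one more ascent (rule (i) elsewhere), M with one more ascent and up-arrow (rule (ii)) and
--     M with one more down-arrow (rule (iii)).  Counting ascents needs the invariant that
--     ascent sets are strictly increasing within [1, M] (WellFormed).  Extracting the
--     coefficient of x^k u^a d^b gives the recurrence for one parent, and it is linear, so it
--     sums over GS_M.
--   * ExponentialGF shows that each operator of the equation acts on normalised coefficients
--     F(n,k,a,b)/n! as a simple shift or scaling, so that any series whose normalised
--     coefficients satisfy the recurrence satisfies the equation (recurrence⇒equation).

open import Defs
open import Data.Nat using (ℕ)
open import Relation.Binary.PropositionalEquality using (_≡_)

module GeneralizedPermutations where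

  open import Data.Nat using (zero; suc; _+_; _*_; _∸_; _≤_; _<_; z≤n; s≤s; _≟_; _<?_; _≤?_)
  open import Data.Nat.Properties
  open import Data.Bool using (true; false; if_then_else_)
  open import Data.List using (List; []; _∷_; _++_; map; filter; length; concatMap; upTo; applyUpTo)
  open import Data.List.Properties using (length-map; length-++; filter-accept; filter-reject)
  open import Data.List.Relation.Unary.All as All using (All; []; _∷_)
  import Data.List.Relation.Unary.All.Properties as All
  open import Data.Product using (_×_; _,_)
  open import Data.Unit using (⊤; tt)
  open import Relation.Nullary using (Dec; does; ¬_; yes; no)
  open import Relation.Nullary.Decidable using (_×-dec_; dec-true; dec-false)
  open import Relation.Binary.PropositionalEquality
  open import Relation.Binary.Definitions using (tri<; tri≈; tri>)
  open import Data.Nat.Tactic.RingSolver using (solve-∀)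
  open import Algebra.Properties.CommutativeSemigroup +-commutativeSemigroup using (interchange; x∙yz≈y∙xz)

  sumBy : {A : Set} → (A → ℕ) → List A → ℕ
  sumBy f []       = 0
  sumBy f (x ∷ xs) = f x + sumBy f xs

  sumBy-++ : ∀ {A : Set} (f : A → ℕ) xs ys → sumBy f (xs ++ ys) ≡ sumBy f xs + sumBy f ys
  sumBy-++ f []       ys = refl
  sumBy-++ f (x ∷ xs) ys = trans (cong (f x +_) (sumBy-++ f xs ys)) (sym (+-assoc (f x) _ _))

  sumBy-map : ∀ {A B : Set} (f : B → ℕ) (g : A → B) xs → sumBy f (map g xs) ≡ sumBy (λ x → f (g x)) xs
  sumBy-map f g []       = refl
  sumBy-map f g (x ∷ xs) = cong (f (g x) +_) (sumBy-map f g xs)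

  sumBy-concatMap : ∀ {A B : Set} (f : B → ℕ) (g : A → List B) xs →
    sumBy f (concatMap g xs) ≡ sumBy (λ x → sumBy f (g x)) xs
  sumBy-concatMap f g []       = refl
  sumBy-concatMap f g (x ∷ xs) =
    trans (sumBy-++ f (g x) (concatMap g xs)) (cong (sumBy f (g x) +_) (sumBy-concatMap f g xs))

  sumBy-congᴬ : ∀ {A : Set} {P : A → Set} {f g : A → ℕ} {xs} →
    All P xs → (∀ x → P x → f x ≡ g x) → sumBy f xs ≡ sumBy g xs
  sumBy-congᴬ []         eq = refl
  sumBy-congᴬ (px ∷ pxs) eq = cong₂ _+_ (eq _ px) (sumBy-congᴬ pxs eq)

  sumBy-cong : ∀ {A : Set} {f g : A → ℕ} xs → (∀ x → f x ≡ g x) → sumBy f xs ≡ sumBy g xs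
  sumBy-cong []       eq = refl
  sumBy-cong (x ∷ xs) eq = cong₂ _+_ (eq x) (sumBy-cong xs eq)

  sumBy-+ : ∀ {A : Set} (f g : A → ℕ) xs → sumBy (λ x → f x + g x) xs ≡ sumBy f xs + sumBy g xs
  sumBy-+ f g []       = refl
  sumBy-+ f g (x ∷ xs) = trans (cong (f x + g x +_) (sumBy-+ f g xs)) (interchange (f x) (g x) _ _)

  sumBy-* : ∀ {A : Set} c (f : A → ℕ) xs → sumBy (λ x → c * f x) xs ≡ c * sumBy f xs
  sumBy-* c f []       = sym (*-zeroʳ c)
  sumBy-* c f (x ∷ xs) = trans (cong (c * f x +_) (sumBy-* c f xs)) (sym (*-distribˡ-+ c (f x) _))

  sumBy-length : ∀ {A : Set} (xs : List A) → sumBy (λ _ → 1) xs ≡ length xs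
  sumBy-length []       = refl
  sumBy-length (x ∷ xs) = cong suc (sumBy-length xs)

  sumBy-insertAt : ∀ {A : Set} (f : A → ℕ) j x ys → sumBy f (insertAt j x ys) ≡ sumBy f (x ∷ ys)
  sumBy-insertAt f zero    x ys       = refl
  sumBy-insertAt f (suc j) x []       = refl
  sumBy-insertAt f (suc j) x (y ∷ ys) =
    trans (cong (f y +_) (sumBy-insertAt f j x ys)) (x∙yz≈y∙xz (f y) (f x) _)

  -- Σ_{j < n} h j, unfolded from the bottom so that sums of Kronecker deltas compute; it is
  -- the sum over the gap/position lists built with upTo.
  sumBelow : ℕ → (ℕ → ℕ) → ℕ
  sumBelow zero    h = 0
  sumBelow (suc n) h = h 0 + sumBelow n (λ j → h (suc j))

  sumBy-applyUpTo : ∀ {A : Set} (f : A → ℕ) (g : ℕ → A) n →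
    sumBy f (applyUpTo g n) ≡ sumBelow n (λ j → f (g j))
  sumBy-applyUpTo f g zero    = refl
  sumBy-applyUpTo f g (suc n) = cong (f (g 0) +_) (sumBy-applyUpTo f (λ j → g (suc j)) n)

  sumBelow-cong : ∀ {h h′ : ℕ → ℕ} n → (∀ j → h j ≡ h′ j) → sumBelow n h ≡ sumBelow n h′
  sumBelow-cong zero    eq = refl
  sumBelow-cong (suc n) eq = cong₂ _+_ (eq 0) (sumBelow-cong n (λ j → eq (suc j)))

  sumBelow-const : ∀ c n → sumBelow n (λ _ → c) ≡ n * c
  sumBelow-const c zero    = refl
  sumBelow-const c (suc n) = cong (c +_) (sumBelow-const c n)

  sumBelow-+ : ∀ (h h′ : ℕ → ℕ) n → sumBelow n (λ j → h j + h′ j) ≡ sumBelow n h + sumBelow n h′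
  sumBelow-+ h h′ zero    = refl
  sumBelow-+ h h′ (suc n) =
    trans (cong (h 0 + h′ 0 +_) (sumBelow-+ (λ j → h (suc j)) (λ j → h′ (suc j)) n))
          (interchange (h 0) (h′ 0) _ _)

  sumBelow-*ʳ : ∀ c (h : ℕ → ℕ) n → sumBelow n (λ j → h j * c) ≡ sumBelow n h * c
  sumBelow-*ʳ c h zero    = refl
  sumBelow-*ʳ c h (suc n) =
    trans (cong (h 0 * c +_) (sumBelow-*ʳ c (λ j → h (suc j)) n)) (sym (*-distribʳ-+ c (h 0) _))

  -- prev k f = f (k − 1), and 0 for k = 0: the coefficient of z^k in z · Σ f(i) z^i.
  -- It commutes with sums, which makes the recurrence linear.
  prev : ℕ → (ℕ → ℕ) → ℕ
  prev zero    f = 0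
  prev (suc k) f = f k

  prev-cong : ∀ k {f g : ℕ → ℕ} → (∀ i → f i ≡ g i) → prev k f ≡ prev k g
  prev-cong zero    eq = refl
  prev-cong (suc k) eq = eq k

  sumBy-prev : ∀ {A : Set} k (f : A → ℕ → ℕ) xs →
    sumBy (λ x → prev k (f x)) xs ≡ prev k (λ i → sumBy (λ x → f x i) xs)
  sumBy-prev zero    f []       = refl
  sumBy-prev zero    f (x ∷ xs) = sumBy-prev zero f xs
  sumBy-prev (suc k) f xs       = refl

  𝟙 : ∀ {P : Set} → Dec P → ℕ
  𝟙 P? = if does P? then 1 else 0

  𝟙-yes : ∀ {P : Set} (P? : Dec P) → P → 𝟙 P? ≡ 1
  𝟙-yes P? p rewrite dec-true P? p = refl

  𝟙-no : ∀ {P : Set} (P? : Dec P) → ¬ P → 𝟙 P? ≡ 0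
  𝟙-no P? ¬p rewrite dec-false P? ¬p = refl

  𝟙-× : ∀ {P Q : Set} (P? : Dec P) (Q? : Dec Q) → 𝟙 (P? ×-dec Q?) ≡ 𝟙 P? * 𝟙 Q?
  𝟙-× P? Q? with does P? | does Q?
  ... | false | _     = refl
  ... | true  | false = refl
  ... | true  | true  = refl

  δ : ℕ → ℕ → ℕ
  δ x y = 𝟙 (x ≟ y)

  length-filter : ∀ {A : Set} {P : A → Set} (P? : ∀ x → Dec (P x)) xs →
    length (filter P? xs) ≡ sumBy (λ x → 𝟙 (P? x)) xs
  length-filter P? []       = refl
  length-filter P? (x ∷ xs) with does (P? x)
  ... | true  = cong suc (length-filter P? xs)
  ... | false = length-filter P? xs

  Ascending : ℕ → ℕ → List ℕ → Set
  Ascending lo hi []       = ⊤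
  Ascending lo hi (x ∷ xs) = lo < x × x ≤ hi × Ascending x hi xs

  ascending-weaken : ∀ {lo′ lo hi} xs → lo′ ≤ lo → Ascending lo hi xs → Ascending lo′ hi xs
  ascending-weaken []       _ _                = tt
  ascending-weaken (x ∷ xs) p (lo<x , x≤hi , s) = ≤-<-trans p lo<x , x≤hi , s

  ascending-suc : ∀ {lo hi} xs → Ascending lo hi xs → Ascending (suc lo) (suc hi) (map suc xs)
  ascending-suc []       _                  = tt
  ascending-suc (x ∷ xs) (lo<x , x≤hi , s) = s≤s lo<x , s≤s x≤hi , ascending-suc xs s

  ascending-length : ∀ {lo hi} xs → Ascending lo hi xs → length xs ≤ hi ∸ lo
  ascending-length []       _                  = z≤n
  ascending-length (x ∷ xs) (lo<x , x≤hi , s) =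
    ≤-trans (s≤s (ascending-length xs s)) (∸-monoʳ-< lo<x x≤hi)

  filter-below-none : ∀ {lo hi} t xs → t ≤ suc lo → Ascending lo hi xs → filter (_<? t) xs ≡ []
  filter-below-none t []       _ _                  = refl
  filter-below-none t (x ∷ xs) p (lo<x , _ , s) =
    trans (filter-reject (_<? t) (λ x<t → <⇒≱ lo<x (≤-pred (≤-trans x<t p))))
          (filter-below-none t xs (m≤n⇒m≤1+n (≤-trans p lo<x)) s)

  filter-above-all : ∀ {lo hi} t xs → t ≤ suc lo → Ascending lo hi xs → filter (t ≤?_) xs ≡ xs
  filter-above-all t []       _ _                  = refl
  filter-above-all t (x ∷ xs) p (lo<x , _ , s) =
    trans (filter-accept (t ≤?_) (≤-trans p lo<x))
          (cong (x ∷_) (filter-above-all t xs (m≤n⇒m≤1+n (≤-trans p lo<x)) s))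

  ascending-insert : ∀ {lo hi} i t xs → i ≤ t → t ≤ suc i → lo < i → i ≤ suc hi →
    Ascending lo hi xs → Ascending lo (suc hi) (filter (_<? i) xs ++ i ∷ map suc (filter (t ≤?_) xs))
  ascending-insert i t []       _   _   lo<i i≤hi _ = lo<i , i≤hi , tt
  ascending-insert i t (x ∷ xs) i≤t t≤i lo<i i≤hi (lo<x , x≤hi , s) with x <? i
  ... | yes x<i rewrite filter-accept (_<? i) {xs = xs} x<i
                     | filter-reject (t ≤?_) {xs = xs} (<⇒≱ (<-≤-trans x<i i≤t)) =
    lo<x , m≤n⇒m≤1+n x≤hi , ascending-insert i t xs i≤t t≤i x<i i≤hi s
  ... | no x≮i rewrite filter-reject (_<? i) {xs = xs} x≮i
                     | filter-below-none i xs (m≤n⇒m≤1+n (≮⇒≥ x≮i)) s with t ≤? x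
  ...   | yes t≤x rewrite filter-accept (t ≤?_) {xs = xs} t≤x
                        | filter-above-all t xs (m≤n⇒m≤1+n t≤x) s =
    lo<i , i≤hi , s≤s (≮⇒≥ x≮i) , s≤s x≤hi , ascending-suc xs s
  ...   | no t≰x rewrite filter-reject (t ≤?_) {xs = xs} t≰x
                       | filter-above-all t xs (≤-trans t≤i (s≤s (≮⇒≥ x≮i))) s =
    lo<i , i≤hi , ascending-weaken (map suc xs) (m≤n⇒m≤1+n (≮⇒≥ x≮i)) (ascending-suc xs s)

  ascending-delete : ∀ {lo hi i ys} xs → Ascending lo hi (xs ++ i ∷ ys) → Ascending lo hi (xs ++ ys)
  ascending-delete {ys = ys} [] (lo<i , _ , s)       = ascending-weaken ys (<⇒≤ lo<i) s
  ascending-delete (x ∷ xs) (lo<x , x≤hi , s) = lo<x , x≤hi , ascending-delete xs s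

  WellFormed : ℕ → GP → Set
  WellFormed n π = Ascending 0 n (asc π)

  -- Each rule preserves well-formedness; rule (iii) is rule (ii) with the new ascent deleted.
  ruleI-wellFormed : ∀ M w A j → j < suc M → WellFormed M (w , A) →
    WellFormed (suc M) (ruleI (suc M) (w , A) j)
  ruleI-wellFormed M w A zero    _       s = ascending-weaken (map suc A) z≤n (ascending-suc A s)
  ruleI-wellFormed M w A (suc j) (s≤s j<M) s =
    ascending-insert (suc j) (suc (suc j)) A (n≤1+n _) ≤-refl (s≤s z≤n) (m≤n⇒m≤1+n j<M) s

  ruleII-wellFormed : ∀ M w A i → 0 < i → i ≤ M → WellFormed M (w , A) →
    WellFormed (suc M) (ruleII (suc M) (w , A) i)
  ruleII-wellFormed M w A i 0<i i≤M s = ascending-insert i i A ≤-refl (n≤1+n i) 0<i (m≤n⇒m≤1+n i≤M) s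

  ruleIII-wellFormed : ∀ M w A i → 0 < i → i ≤ M → WellFormed M (w , A) →
    WellFormed (suc M) (ruleIII (suc M) (w , A) i)
  ruleIII-wellFormed M w A i 0<i i≤M s =
    ascending-delete (filter (_<? i) A) (ruleII-wellFormed M w A i 0<i i≤M s)

  children-wellFormed : ∀ M π → WellFormed M π → All (WellFormed (suc M)) (children M π)
  children-wellFormed M (w , A) s =
    All.++⁺ (All.map⁺ (All.applyUpTo⁺₁ (λ j → j) (suc M) (λ j<1+M → ruleI-wellFormed M w A _ j<1+M s)))
   (All.++⁺ (All.map⁺ (All.map⁺ (All.applyUpTo⁺₁ (λ j → j) M
                        (λ j<M → ruleII-wellFormed M w A _ (s≤s z≤n) j<M s))))
            (All.map⁺ (All.map⁺ (All.applyUpTo⁺₁ (λ j → j) M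
                        (λ j<M → ruleIII-wellFormed M w A _ (s≤s z≤n) j<M s)))))

  GS-wellFormed : ∀ n → All (WellFormed n) (GS n)
  GS-wellFormed zero          = []
  GS-wellFormed (suc zero)    = tt ∷ []
  GS-wellFormed (suc (suc m)) =
    All.concat⁺ (All.map⁺ (All.map (λ {π} → children-wellFormed (suc m) π) (GS-wellFormed (suc m))))

  occ : ℕ → List ℕ → ℕ
  occ j xs = sumBy (λ x → δ x j) xs

  sumBy-complementary : ∀ {A : Set} (f g : A → ℕ) xs → (∀ x → f x + g x ≡ 1) →
    sumBy f xs + sumBy g xs ≡ length xs
  sumBy-complementary f g xs eq = trans (sym (sumBy-+ f g xs)) (trans (sumBy-cong xs eq) (sumBy-length xs))

  threshold-split : ∀ j xs →
    length (filter (_<? j) xs) + (occ j xs + length (filter (j <?_) xs)) ≡ length xs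
  threshold-split j xs = begin
    length (filter (_<? j) xs) + (occ j xs + length (filter (j <?_) xs))
      ≡⟨ cong₂ (λ p q → p + (occ j xs + q)) (length-filter (_<? j) xs) (length-filter (j <?_) xs) ⟩
    sumBy (λ x → 𝟙 (x <? j)) xs + (occ j xs + sumBy (λ x → 𝟙 (j <? x)) xs)
      ≡⟨ cong (sumBy (λ x → 𝟙 (x <? j)) xs +_) (sym (sumBy-+ (λ x → δ x j) (λ x → 𝟙 (j <? x)) xs)) ⟩
    sumBy (λ x → 𝟙 (x <? j)) xs + sumBy (λ x → δ x j + 𝟙 (j <? x)) xs
      ≡⟨ sumBy-complementary _ _ xs trichotomy ⟩
    length xs ∎
    where
    open ≡-Reasoning
    trichotomy : ∀ x → 𝟙 (x <? j) + (δ x j + 𝟙 (j <? x)) ≡ 1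
    trichotomy x with <-cmp x j
    ... | tri< x<j x≢j x≯j rewrite 𝟙-yes (x <? j) x<j | 𝟙-no (x ≟ j) x≢j | 𝟙-no (j <? x) x≯j = refl
    ... | tri≈ x≮j x≡j x≯j rewrite 𝟙-no (x <? j) x≮j | 𝟙-yes (x ≟ j) x≡j | 𝟙-no (j <? x) x≯j = refl
    ... | tri> x≮j x≢j x>j rewrite 𝟙-no (x <? j) x≮j | 𝟙-no (x ≟ j) x≢j | 𝟙-yes (j <? x) x>j = refl

  threshold-partition : ∀ i xs → length (filter (_<? i) xs) + length (filter (i ≤?_) xs) ≡ length xs
  threshold-partition i xs =
    trans (cong₂ _+_ (length-filter (_<? i) xs) (length-filter (i ≤?_) xs))
          (sumBy-complementary _ _ xs dichotomy)
    where
    dichotomy : ∀ x → 𝟙 (x <? i) + 𝟙 (i ≤? x) ≡ 1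
    dichotomy x with x <? i
    ... | yes x<i rewrite 𝟙-yes (x <? i) x<i | 𝟙-no (i ≤? x) (<⇒≱ x<i) = refl
    ... | no  x≮i rewrite 𝟙-no (x <? i) x≮i | 𝟙-yes (i ≤? x) (≮⇒≥ x≮i) = refl

  occ-below : ∀ {lo hi} j xs → j ≤ lo → Ascending lo hi xs → occ j xs ≡ 0
  occ-below j []       _ _                = refl
  occ-below j (x ∷ xs) p (lo<x , _ , s) rewrite 𝟙-no (x ≟ j) (λ x≡j → <⇒≢ (≤-<-trans p lo<x) (sym x≡j)) =
    occ-below j xs (<⇒≤ (≤-<-trans p lo<x)) s

  occ-≤1 : ∀ {lo hi} j xs → Ascending lo hi xs → occ j xs ≤ 1
  occ-≤1 j []       _               = z≤n
  occ-≤1 j (x ∷ xs) (_ , _ , s) with x ≟ j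
  ... | yes refl rewrite 𝟙-yes (x ≟ x) refl | occ-below x xs ≤-refl s = ≤-refl
  ... | no  x≢j  rewrite 𝟙-no (x ≟ j) x≢j = occ-≤1 j xs s

  sumBelow-δ : ∀ y n → y < n → sumBelow n (λ j → δ y j) ≡ 1
  sumBelow-δ zero    (suc n) _         = cong suc (trans (sumBelow-const 0 n) (*-zeroʳ n))
  sumBelow-δ (suc y) (suc n) (s≤s y<n) = sumBelow-δ y n y<n

  occ-total : ∀ M xs → Ascending 0 M xs → sumBelow M (λ j → occ (suc j) xs) ≡ length xs
  occ-total M []             _                   = trans (sumBelow-const 0 M) (*-zeroʳ M)
  occ-total M (suc y ∷ xs) (_ , y<M , s) =
    trans (sumBelow-+ (λ j → δ y j) (λ j → occ (suc j) xs) M)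
          (cong₂ _+_ (sumBelow-δ y M y<M) (occ-total M xs (ascending-weaken xs z≤n s)))

  gaps-outside : ∀ M xs → Ascending 0 M xs → sumBelow M (λ j → 1 ∸ occ (suc j) xs) ≡ M ∸ length xs
  gaps-outside M xs s = begin
    sumBelow M (λ j → 1 ∸ occ (suc j) xs)
      ≡⟨ sym (m+n∸m≡n (length xs) _) ⟩
    length xs + sumBelow M (λ j → 1 ∸ occ (suc j) xs) ∸ length xs
      ≡⟨ cong (λ ℓ → ℓ + sumBelow M (λ j → 1 ∸ occ (suc j) xs) ∸ length xs) (sym (occ-total M xs s)) ⟩
    sumBelow M (λ j → occ (suc j) xs) + sumBelow M (λ j → 1 ∸ occ (suc j) xs) ∸ length xs
      ≡⟨ cong (_∸ length xs) (sym (sumBelow-+ _ _ M)) ⟩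
    sumBelow M (λ j → occ (suc j) xs + (1 ∸ occ (suc j) xs)) ∸ length xs
      ≡⟨ cong (_∸ length xs) (sumBelow-cong M (λ j → m+[n∸m]≡n (occ-≤1 (suc j) xs s))) ⟩
    sumBelow M (λ _ → 1) ∸ length xs
      ≡⟨ cong (_∸ length xs) (trans (sumBelow-const 1 M) (*-identityʳ M)) ⟩
    M ∸ length xs ∎
    where open ≡-Reasoning

  Weight : Set
  Weight = ℕ → ℕ → ℕ → ℕ

  weigh : Weight → GP → ℕ
  weigh f π = f (length (asc π)) (nua π) (nda π)

  weigh-≡ : ∀ f π {ℓ u d} → length (asc π) ≡ ℓ → nua π ≡ u → nda π ≡ d → weigh f π ≡ f ℓ u d
  weigh-≡ f π refl refl refl = refl

  -- Arrow counts are sums of per-tile contributions, hence blind to the insertion position.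
  isUp isDown : Tile → ℕ
  isUp   (_ , up)   = 1
  isUp   _          = 0
  isDown (_ , down) = 1
  isDown _          = 0

  countUp-sumBy : ∀ w → countUp w ≡ sumBy isUp w
  countUp-sumBy []              = refl
  countUp-sumBy ((_ , none) ∷ w) = countUp-sumBy w
  countUp-sumBy ((_ , up)   ∷ w) = cong suc (countUp-sumBy w)
  countUp-sumBy ((_ , down) ∷ w) = countUp-sumBy w

  countDown-sumBy : ∀ w → countDown w ≡ sumBy isDown w
  countDown-sumBy []              = refl
  countDown-sumBy ((_ , none) ∷ w) = countDown-sumBy w
  countDown-sumBy ((_ , up)   ∷ w) = countDown-sumBy w
  countDown-sumBy ((_ , down) ∷ w) = cong suc (countDown-sumBy w)

  countUp-insertAt : ∀ j t w → countUp (insertAt j t w) ≡ countUp (t ∷ w)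
  countUp-insertAt j t w =
    trans (countUp-sumBy (insertAt j t w))
          (trans (sumBy-insertAt isUp j t w) (sym (countUp-sumBy (t ∷ w))))

  countDown-insertAt : ∀ j t w → countDown (insertAt j t w) ≡ countDown (t ∷ w)
  countDown-insertAt j t w =
    trans (countDown-sumBy (insertAt j t w))
          (trans (sumBy-insertAt isDown j t w) (sym (countDown-sumBy (t ∷ w))))

  ruleI-ascents : ∀ n w A j → occ (suc j) A ≤ 1 →
    length (asc (ruleI n (w , A) (suc j))) ≡ length A + (1 ∸ occ (suc j) A)
  ruleI-ascents n w A j occ≤1 = begin
    length (below ++ suc j ∷ map suc above)
      ≡⟨ length-++ below ⟩
    length below + suc (length (map suc above))
      ≡⟨ cong (λ m → length below + suc m) (length-map suc above) ⟩
    length below + suc (length above)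
      ≡⟨ one-more (length below) (length above) occ≤1 ⟩
    length below + (occ (suc j) A + length above) + (1 ∸ occ (suc j) A)
      ≡⟨ cong (_+ (1 ∸ occ (suc j) A)) (threshold-split (suc j) A) ⟩
    length A + (1 ∸ occ (suc j) A) ∎
    where
    open ≡-Reasoning
    below above : List ℕ
    below = filter (_<? suc j) A
    above = filter (suc j <?_) A
    one-more : ∀ l₁ l₂ {c} → c ≤ 1 → l₁ + suc l₂ ≡ l₁ + (c + l₂) + (1 ∸ c)
    one-more l₁ l₂ {zero}  _       = trans (+-suc l₁ l₂) (sym (+-comm (l₁ + l₂) 1))
    one-more l₁ l₂ {suc zero} _    = sym (+-identityʳ _)
    one-more l₁ l₂ {suc (suc _)} (s≤s ())

  ruleII-ascents : ∀ n w A i → length (asc (ruleII n (w , A) i)) ≡ suc (length A)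
  ruleII-ascents n w A i
    rewrite length-++ (filter (_<? i) A) {i ∷ map suc (filter (i ≤?_) A)}
          | length-map suc (filter (i ≤?_) A)
          | +-suc (length (filter (_<? i) A)) (length (filter (i ≤?_) A))
          = cong suc (threshold-partition i A)

  ruleIII-ascents : ∀ n w A i → length (asc (ruleIII n (w , A) i)) ≡ length A
  ruleIII-ascents n w A i
    rewrite length-++ (filter (_<? i) A) {map suc (filter (i ≤?_) A)}
          | length-map suc (filter (i ≤?_) A)
          = threshold-partition i A

  weigh-ruleI-zero : ∀ f n w A → weigh f (ruleI n (w , A) 0) ≡ f (length A) (countUp w) (countDown w)
  weigh-ruleI-zero f n w A = cong (λ ℓ → f ℓ (countUp w) (countDown w)) (length-map suc A)

  weigh-ruleI : ∀ f n w A j → occ (suc j) A ≤ 1 →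
    weigh f (ruleI n (w , A) (suc j)) ≡ f (length A + (1 ∸ occ (suc j) A)) (countUp w) (countDown w)
  weigh-ruleI f n w A j occ≤1 =
    weigh-≡ f (ruleI n (w , A) (suc j)) (ruleI-ascents n w A j occ≤1) (countUp-insertAt (suc j) (n , none) w)
                (countDown-insertAt (suc j) (n , none) w)

  weigh-ruleII : ∀ f n w A j →
    weigh f (ruleII n (w , A) (suc j)) ≡ f (suc (length A)) (suc (countUp w)) (countDown w)
  weigh-ruleII f n w A j =
    weigh-≡ f (ruleII n (w , A) (suc j)) (ruleII-ascents n w A (suc j)) (countUp-insertAt j (n , up) w)
                (countDown-insertAt j (n , up) w)

  weigh-ruleIII : ∀ f n w A j →
    weigh f (ruleIII n (w , A) (suc j)) ≡ f (length A) (countUp w) (suc (countDown w))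
  weigh-ruleIII f n w A j =
    weigh-≡ f (ruleIII n (w , A) (suc j)) (ruleIII-ascents n w A (suc j)) (countUp-insertAt j (n , down) w)
                (countDown-insertAt j (n , down) w)

  select : ∀ (g : ℕ → ℕ) ℓ {c} → c ≤ 1 → g (ℓ + (1 ∸ c)) ≡ c * g ℓ + (1 ∸ c) * g (suc ℓ)
  select g ℓ {zero}        _       = trans (cong g (+-comm ℓ 1)) (sym (+-identityʳ _))
  select g ℓ {suc zero}    _       = trans (cong g (+-identityʳ ℓ)) (sym (trans (+-identityʳ _) (+-identityʳ _)))
  select g ℓ {suc (suc _)} (s≤s ())

  -- Rule (i): the ℓ + 1 gaps 0 and j ∈ A keep ℓ ascents, the M − ℓ others add one.
  ruleI-children : ∀ f M w A → WellFormed M (w , A) →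
    let ℓ = length A; u = countUp w; d = countDown w in
    sumBy (weigh f) (map (ruleI (suc M) (w , A)) (upTo (suc M)))
      ≡ suc ℓ * f ℓ u d + (M ∸ ℓ) * f (suc ℓ) u d
  ruleI-children f M w A s = begin
    sumBy (weigh f) (map child (upTo (suc M)))
      ≡⟨ sumBy-map (weigh f) child (upTo (suc M)) ⟩
    sumBy (λ j → weigh f (child j)) (upTo (suc M))
      ≡⟨ sumBy-applyUpTo (λ j → weigh f (child j)) (λ j → j) (suc M) ⟩
    weigh f (child 0) + sumBelow M (λ j → weigh f (child (suc j)))
      ≡⟨ cong₂ _+_ (weigh-ruleI-zero f (suc M) w A) (sumBelow-cong M gap) ⟩
    X + sumBelow M (λ j → occ (suc j) A * X + (1 ∸ occ (suc j) A) * Y)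
      ≡⟨ cong (X +_) (sumBelow-+ (λ j → occ (suc j) A * X) (λ j → (1 ∸ occ (suc j) A) * Y) M) ⟩
    X + (sumBelow M (λ j → occ (suc j) A * X) + sumBelow M (λ j → (1 ∸ occ (suc j) A) * Y))
      ≡⟨ cong (X +_) (cong₂ _+_ (trans (sumBelow-*ʳ X _ M) (cong (_* X) (occ-total M A s)))
                                 (trans (sumBelow-*ʳ Y _ M) (cong (_* Y) (gaps-outside M A s)))) ⟩
    X + (length A * X + (M ∸ length A) * Y)
      ≡⟨ sym (+-assoc X _ _) ⟩
    suc (length A) * X + (M ∸ length A) * Y ∎
    where
    open ≡-Reasoning
    child : ℕ → GP
    child = ruleI (suc M) (w , A)
    X Y : ℕ
    X = f (length A) (countUp w) (countDown w)
    Y = f (suc (length A)) (countUp w) (countDown w)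
    gap : ∀ j → weigh f (child (suc j)) ≡ occ (suc j) A * X + (1 ∸ occ (suc j) A) * Y
    gap j = trans (weigh-ruleI f (suc M) w A j (occ-≤1 (suc j) A s))
                  (select (λ ℓ → f ℓ (countUp w) (countDown w)) (length A) (occ-≤1 (suc j) A s))

  sumBy-positions : ∀ (g : GP → ℕ) (child : ℕ → GP) M c → (∀ j → g (child (suc j)) ≡ c) →
    sumBy g (map child (map suc (upTo M))) ≡ M * c
  sumBy-positions g child M c eq = begin
    sumBy g (map child (map suc (upTo M)))
      ≡⟨ sumBy-map g child (map suc (upTo M)) ⟩
    sumBy (λ i → g (child i)) (map suc (upTo M))
      ≡⟨ sumBy-map (λ i → g (child i)) suc (upTo M) ⟩
    sumBy (λ j → g (child (suc j))) (upTo M)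
      ≡⟨ sumBy-applyUpTo (λ j → g (child (suc j))) (λ j → j) M ⟩
    sumBelow M (λ j → g (child (suc j)))
      ≡⟨ sumBelow-cong M eq ⟩
    sumBelow M (λ _ → c)
      ≡⟨ sumBelow-const c M ⟩
    M * c ∎
    where open ≡-Reasoning

  children-statistics : ∀ f M w A → WellFormed M (w , A) →
    let ℓ = length A; u = countUp w; d = countDown w in
    sumBy (weigh f) (children M (w , A))
      ≡ suc ℓ * f ℓ u d + (M ∸ ℓ) * f (suc ℓ) u d + M * f (suc ℓ) (suc u) d + M * f ℓ u (suc d)
  children-statistics f M w A s = begin
    sumBy (weigh f) (childrenI ++ childrenII ++ childrenIII)
      ≡⟨ sumBy-++ (weigh f) childrenI (childrenII ++ childrenIII) ⟩
    sumBy (weigh f) childrenI + sumBy (weigh f) (childrenII ++ childrenIII)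
      ≡⟨ cong (sumBy (weigh f) childrenI +_) (sumBy-++ (weigh f) childrenII childrenIII) ⟩
    sumBy (weigh f) childrenI + (sumBy (weigh f) childrenII + sumBy (weigh f) childrenIII)
      ≡⟨ cong₂ _+_ (ruleI-children f M w A s)
           (cong₂ _+_ (sumBy-positions (weigh f) (ruleII (suc M) (w , A)) M Z (weigh-ruleII f (suc M) w A))
                      (sumBy-positions (weigh f) (ruleIII (suc M) (w , A)) M W (weigh-ruleIII f (suc M) w A))) ⟩
    I + (M * Z + M * W)
      ≡⟨ sym (+-assoc I (M * Z) (M * W)) ⟩
    I + M * Z + M * W ∎
    where
    open ≡-Reasoning
    childrenI childrenII childrenIII : List GP
    childrenI   = map (ruleI (suc M) (w , A)) (upTo (suc M))
    childrenII  = map (ruleII (suc M) (w , A)) (map suc (upTo M))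
    childrenIII = map (ruleIII (suc M) (w , A)) (map suc (upTo M))
    ℓ I Z W : ℕ
    ℓ = length A
    I = suc ℓ * f ℓ (countUp w) (countDown w) + (M ∸ ℓ) * f (suc ℓ) (countUp w) (countDown w)
    Z = f (suc ℓ) (suc (countUp w)) (countDown w)
    W = f ℓ (countUp w) (suc (countDown w))

  -- Coefficient families: F k a b is the coefficient of x^k u^a d^b.
  Coeff : Set
  Coeff = ℕ → ℕ → ℕ → ℕ

  -- Coefficients of x² ∂F/∂x and of ((1 + u) x + d) F.
  x²∂x : Coeff → Coeff
  x²∂x F k a b = prev k (λ i → i * F i a b)

  mul[x+ux+d] : Coeff → Coeff
  mul[x+ux+d] F k a b = prev k (λ i → F i a b) + prev a (λ j → prev k (λ i → F i j b)) + prev b (λ j → F k a j)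

  x²∂x-cong : ∀ {F F′ : Coeff} → (∀ k a b → F k a b ≡ F′ k a b) →
    ∀ k a b → x²∂x F k a b ≡ x²∂x F′ k a b
  x²∂x-cong eq k a b = prev-cong k (λ i → cong (i *_) (eq i a b))

  mul[x+ux+d]-cong : ∀ {F F′ : Coeff} → (∀ k a b → F k a b ≡ F′ k a b) →
    ∀ k a b → mul[x+ux+d] F k a b ≡ mul[x+ux+d] F′ k a b
  mul[x+ux+d]-cong eq k a b =
    cong₂ _+_ (cong₂ _+_ (prev-cong k (λ i → eq i a b)) (prev-cong a (λ j → prev-cong k (λ i → eq i j b))))
              (prev-cong b (λ j → eq k a j))

  Recurrence : (ℕ → Coeff) → Set
  Recurrence F = ∀ n k a b →
    F (suc n) k a b + x²∂x (F n) k a b ≡ suc k * F n k a b + n * mul[x+ux+d] (F n) k a b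

  hits : ℕ → ℕ → ℕ → Weight
  hits k a b ℓ u d = δ ℓ k * (δ u a * δ d b)

  monomial : GP → Coeff
  monomial π k a b = weigh (hits k a b) π

  hits-diagonal : ∀ k a b ℓ u d → ℓ * hits k a b ℓ u d ≡ k * hits k a b ℓ u d
  hits-diagonal k a b ℓ u d with ℓ ≟ k
  ... | yes refl = refl
  ... | no  ℓ≢k rewrite 𝟙-no (ℓ ≟ k) ℓ≢k = trans (*-zeroʳ ℓ) (sym (*-zeroʳ k))

  hits-ascent : ∀ k a b ℓ u d → hits k a b (suc ℓ) u d ≡ prev k (λ i → hits i a b ℓ u d)
  hits-ascent zero    a b ℓ u d = refl
  hits-ascent (suc k) a b ℓ u d = refl

  hits-up : ∀ k a b ℓ u d → hits k a b (suc ℓ) (suc u) d ≡ prev a (λ j → prev k (λ i → hits i j b ℓ u d))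
  hits-up k       zero    b ℓ u d = *-zeroʳ (δ (suc ℓ) k)
  hits-up zero    (suc a) b ℓ u d = refl
  hits-up (suc k) (suc a) b ℓ u d = refl

  hits-down : ∀ k a b ℓ u d → hits k a b ℓ u (suc d) ≡ prev b (λ j → hits k a j ℓ u d)
  hits-down k a zero    ℓ u d = trans (cong (δ ℓ k *_) (*-zeroʳ (δ u a))) (*-zeroʳ (δ ℓ k))
  hits-down k a (suc b) ℓ u d = refl

  x²∂x-hits : ∀ k a b ℓ u d → x²∂x (λ k a b → hits k a b ℓ u d) k a b ≡ ℓ * hits k a b (suc ℓ) u d
  x²∂x-hits zero    a b ℓ u d = sym (*-zeroʳ ℓ)
  x²∂x-hits (suc k) a b ℓ u d = sym (hits-diagonal k a b ℓ u d)

  -- The M − ℓ new-ascent children and the ℓ·[x^k]x²∂x term together give M.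
  merge-gaps : ∀ {M ℓ} → ℓ ≤ M → ∀ X Y Z W →
    X + (M ∸ ℓ) * Y + M * Z + M * W + ℓ * Y ≡ X + M * (Y + Z + W)
  merge-gaps {M} {ℓ} ℓ≤M X Y Z W =
    subst (λ m → X + (M ∸ ℓ) * Y + m * Z + m * W + ℓ * Y ≡ X + m * (Y + Z + W))
          (m∸n+n≡m ℓ≤M) (arithmetic X (M ∸ ℓ) ℓ Y Z W)
    where
    arithmetic : ∀ X E ℓ Y Z W → X + E * Y + (E + ℓ) * Z + (E + ℓ) * W + ℓ * Y ≡ X + (E + ℓ) * (Y + Z + W)
    arithmetic = solve-∀

  parent-recurrence : ∀ M π k a b → WellFormed M π →
    sumBy (weigh (hits k a b)) (children M π) + x²∂x (monomial π) k a b
      ≡ suc k * monomial π k a b + M * mul[x+ux+d] (monomial π) k a b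
  parent-recurrence M (w , A) k a b s = begin
    sumBy (weigh (hits k a b)) (children M (w , A)) + x²∂x (λ k a b → hits k a b ℓ u d) k a b
      ≡⟨ cong₂ _+_ (children-statistics (hits k a b) M w A s) (x²∂x-hits k a b ℓ u d) ⟩
    suc ℓ * X + (M ∸ ℓ) * Y + M * Z + M * W + ℓ * Y
      ≡⟨ cong (λ t → X + t + (M ∸ ℓ) * Y + M * Z + M * W + ℓ * Y) (hits-diagonal k a b ℓ u d) ⟩
    suc k * X + (M ∸ ℓ) * Y + M * Z + M * W + ℓ * Y
      ≡⟨ merge-gaps (ascending-length A s) (suc k * X) Y Z W ⟩
    suc k * X + M * (Y + Z + W)
      ≡⟨ cong (λ t → suc k * X + M * t)
           (cong₂ _+_ (cong₂ _+_ (hits-ascent k a b ℓ u d) (hits-up k a b ℓ u d)) (hits-down k a b ℓ u d)) ⟩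
    suc k * X + M * mul[x+ux+d] (λ k a b → hits k a b ℓ u d) k a b ∎
    where
    open ≡-Reasoning
    ℓ u d X Y Z W : ℕ
    ℓ = length A
    u = countUp w
    d = countDown w
    X = hits k a b ℓ u d
    Y = hits k a b (suc ℓ) u d
    Z = hits k a b (suc ℓ) (suc u) d
    W = hits k a b ℓ u (suc d)

  sumCoeff : ∀ {A : Set} → (A → Coeff) → List A → Coeff
  sumCoeff C xs k a b = sumBy (λ x → C x k a b) xs

  sumBy-x²∂x : ∀ {A : Set} (C : A → Coeff) xs k a b →
    sumBy (λ x → x²∂x (C x) k a b) xs ≡ x²∂x (sumCoeff C xs) k a b
  sumBy-x²∂x C xs k a b =
    trans (sumBy-prev k (λ x i → i * C x i a b) xs) (prev-cong k (λ i → sumBy-* i (λ x → C x i a b) xs))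

  sumBy-mul[x+ux+d] : ∀ {A : Set} (C : A → Coeff) xs k a b →
    sumBy (λ x → mul[x+ux+d] (C x) k a b) xs ≡ mul[x+ux+d] (sumCoeff C xs) k a b
  sumBy-mul[x+ux+d] {A} C xs k a b = begin
    sumBy (λ x → P x + Q x + R x) xs
      ≡⟨ sumBy-+ (λ x → P x + Q x) R xs ⟩
    sumBy (λ x → P x + Q x) xs + sumBy R xs
      ≡⟨ cong (_+ sumBy R xs) (sumBy-+ P Q xs) ⟩
    sumBy P xs + sumBy Q xs + sumBy R xs
      ≡⟨ cong₂ _+_ (cong₂ _+_ (sumBy-prev k (λ x i → C x i a b) xs)
                              (trans (sumBy-prev a (λ x j → prev k (λ i → C x i j b)) xs)
                                     (prev-cong a (λ j → sumBy-prev k (λ x i → C x i j b) xs))))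
                   (sumBy-prev b (λ x j → C x k a j) xs) ⟩
    mul[x+ux+d] (sumCoeff C xs) k a b ∎
    where
    open ≡-Reasoning
    P Q R : A → ℕ
    P = λ x → prev k (λ i → C x i a b)
    Q = λ x → prev a (λ j → prev k (λ i → C x i j b))
    R = λ x → prev b (λ j → C x k a j)

  sum-recurrence : ∀ {A : Set} {P : A → Set} M k a b (N : A → ℕ) (C : A → Coeff) xs → All P xs →
    (∀ x → P x → N x + x²∂x (C x) k a b ≡ suc k * C x k a b + M * mul[x+ux+d] (C x) k a b) →
    sumBy N xs + x²∂x (sumCoeff C xs) k a b
      ≡ suc k * sumCoeff C xs k a b + M * mul[x+ux+d] (sumCoeff C xs) k a b
  sum-recurrence M k a b N C xs all eq = begin
    sumBy N xs + x²∂x (sumCoeff C xs) k a b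
      ≡⟨ cong (sumBy N xs +_) (sym (sumBy-x²∂x C xs k a b)) ⟩
    sumBy N xs + sumBy (λ x → x²∂x (C x) k a b) xs
      ≡⟨ sym (sumBy-+ N (λ x → x²∂x (C x) k a b) xs) ⟩
    sumBy (λ x → N x + x²∂x (C x) k a b) xs
      ≡⟨ sumBy-congᴬ all eq ⟩
    sumBy (λ x → suc k * C x k a b + M * mul[x+ux+d] (C x) k a b) xs
      ≡⟨ sumBy-+ (λ x → suc k * C x k a b) (λ x → M * mul[x+ux+d] (C x) k a b) xs ⟩
    sumBy (λ x → suc k * C x k a b) xs + sumBy (λ x → M * mul[x+ux+d] (C x) k a b) xs
      ≡⟨ cong₂ _+_ (sumBy-* (suc k) (λ x → C x k a b) xs)
                   (trans (sumBy-* M (λ x → mul[x+ux+d] (C x) k a b) xs)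
                          (cong (M *_) (sumBy-mul[x+ux+d] C xs k a b))) ⟩
    suc k * sumCoeff C xs k a b + M * mul[x+ux+d] (sumCoeff C xs) k a b ∎
    where open ≡-Reasoning

  ACount-sum : ∀ n k a b → ACount (suc n) k a b ≡ sumCoeff monomial (GS (suc n)) k a b
  ACount-sum n k a b =
    trans (length-filter _ (GS (suc n)))
          (sumBy-cong (GS (suc n)) (λ π →
            trans (𝟙-× (length (asc π) ≟ k) ((nua π ≟ a) ×-dec (nda π ≟ b)))
                  (cong (δ (length (asc π)) k *_) (𝟙-× (nua π ≟ a) (nda π ≟ b)))))

  -- The counts of generalized permutations satisfy the recurrence.  For n = 0 both GS_1
  -- and A_0 = 1 consist of the single monomial x^0 u^0 d^0.
  ACount-recurrence : Recurrence ACount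
  ACount-recurrence zero zero          zero    zero    = refl
  ACount-recurrence zero zero          zero    (suc b) = refl
  ACount-recurrence zero zero          (suc a) b       = refl
  ACount-recurrence zero (suc zero)    a       b       = refl
  ACount-recurrence zero (suc (suc k)) a       b       rewrite *-zeroʳ k = refl
  ACount-recurrence (suc m) k a b = begin
    ACount (suc (suc m)) k a b + x²∂x (ACount (suc m)) k a b
      ≡⟨ cong₂ _+_ (trans (ACount-sum (suc m) k a b) (sumBy-concatMap (weigh (hits k a b)) (children (suc m)) L))
                   (x²∂x-cong (ACount-sum m) k a b) ⟩
    sumBy (λ π → sumBy (weigh (hits k a b)) (children (suc m) π)) L + x²∂x (sumCoeff monomial L) k a b
      ≡⟨ sum-recurrence (suc m) k a b _ monomial L (GS-wellFormed (suc m))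
                        (λ π s → parent-recurrence (suc m) π k a b s) ⟩
    suc k * sumCoeff monomial L k a b + suc m * mul[x+ux+d] (sumCoeff monomial L) k a b
      ≡⟨ sym (cong₂ _+_ (cong (suc k *_) (ACount-sum m k a b))
                        (cong (suc m *_) (mul[x+ux+d]-cong (ACount-sum m) k a b))) ⟩
    suc k * ACount (suc m) k a b + suc m * mul[x+ux+d] (ACount (suc m)) k a b ∎
    where
    open ≡-Reasoning
    L : List GP
    L = GS (suc m)

module ExponentialGF where

  open GeneralizedPermutations using (Coeff; prev; x²∂x; mul[x+ux+d]; Recurrence)
  open import Data.Nat as ℕ using (zero; suc; NonZero; _!)
  open import Data.Nat.Properties using (_!≢0)
  open import Data.Integer using (+_)
  import Data.Integer as ℤ
  import Data.Integer.Properties as ℤP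
  open import Data.Rational using (ℚ; _/_; _+_; _*_; -_; 0ℚ; fromℚᵘ)
  open import Data.Rational.Properties
    using (toℚᵘ-injective; toℚᵘ-homo-*; toℚᵘ-homo-+; toℚᵘ-fromℚᵘ; fromℚᵘ-cong; *-zeroˡ; *-assoc)
  import Data.Rational.Unnormalised as ℚᵘ
  import Data.Rational.Unnormalised.Properties as ℚᵘP
  open import Data.Rational.Solver using (module +-*-Solver)
  open import Relation.Binary.PropositionalEquality
  open import Data.Nat.Tactic.RingSolver using (solve-∀)

  fromℚᵘ-* : ∀ p q → fromℚᵘ p * fromℚᵘ q ≡ fromℚᵘ (p ℚᵘ.* q)
  fromℚᵘ-* p q = toℚᵘ-injective
    (ℚᵘP.≃-trans (toℚᵘ-homo-* (fromℚᵘ p) (fromℚᵘ q))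
      (ℚᵘP.≃-trans (ℚᵘP.*-cong (toℚᵘ-fromℚᵘ p) (toℚᵘ-fromℚᵘ q))
                   (ℚᵘP.≃-sym (toℚᵘ-fromℚᵘ (p ℚᵘ.* q)))))

  fromℚᵘ-+ : ∀ p q → fromℚᵘ p + fromℚᵘ q ≡ fromℚᵘ (p ℚᵘ.+ q)
  fromℚᵘ-+ p q = toℚᵘ-injective
    (ℚᵘP.≃-trans (toℚᵘ-homo-+ (fromℚᵘ p) (fromℚᵘ q))
      (ℚᵘP.≃-trans (ℚᵘP.+-cong (toℚᵘ-fromℚᵘ p) (toℚᵘ-fromℚᵘ q))
                   (ℚᵘP.≃-sym (toℚᵘ-fromℚᵘ (p ℚᵘ.+ q)))))

  /-cross : ∀ x y p q .{{_ : NonZero p}} .{{_ : NonZero q}} → x ℕ.* q ≡ y ℕ.* p → + x / p ≡ + y / q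
  /-cross x y (suc p) (suc q) eq = fromℚᵘ-cong {ℚᵘ.mkℚᵘ (+ x) p} {ℚᵘ.mkℚᵘ (+ y) q}
    (ℚᵘ.*≡* (trans (sym (ℤP.pos-* x (suc q))) (trans (cong +_ eq) (ℤP.pos-* y (suc p)))))

  /-* : ∀ x y p q → (+ x / suc p) * (+ y / suc q) ≡ + (x ℕ.* y) / (suc p ℕ.* suc q)
  /-* x y p q = trans (fromℚᵘ-* (ℚᵘ.mkℚᵘ (+ x) p) (ℚᵘ.mkℚᵘ (+ y) q))
                      (cong (λ z → z / (suc p ℕ.* suc q)) (sym (ℤP.pos-* x y)))

  ι : ℕ → ℚ
  ι n = + n / 1

  ι-+ : ∀ x y → ι (x ℕ.+ y) ≡ ι x + ι y
  ι-+ x y = sym (trans (fromℚᵘ-+ (ℚᵘ.mkℚᵘ (+ x) 0) (ℚᵘ.mkℚᵘ (+ y) 0))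
    (fromℚᵘ-cong {ℚᵘ.mkℚᵘ (+ x) 0 ℚᵘ.+ ℚᵘ.mkℚᵘ (+ y) 0} {ℚᵘ.mkℚᵘ (+ (x ℕ.+ y)) 0}
      (ℚᵘ.*≡* (cong (ℤ._* + 1)
      (trans (cong₂ ℤ._+_ (ℤP.*-identityʳ (+ x)) (ℤP.*-identityʳ (+ y))) (sym (ℤP.pos-+ x y)))))))

  ι-* : ∀ x y → ι (x ℕ.* y) ≡ ι x * ι y
  ι-* x y = sym (/-* x y 0 0)

  ι-*-assoc : ∀ m x D → ι m * (ι x * D) ≡ ι (m ℕ.* x) * D
  ι-*-assoc m x D = trans (sym (*-assoc (ι m) (ι x) D)) (cong (_* D) (sym (ι-* m x)))

  invFact : ℕ → ℚ
  invFact n = (+ 1 / n !) {{n !≢0}}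

  /!-ι : ∀ x n → (+ x / n !) {{n !≢0}} ≡ ι x * invFact n
  /!-ι x n = split (n !) {{n !≢0}}
    where
    split : ∀ p .{{_ : NonZero p}} → + x / p ≡ ι x * (+ 1 / p)
    split (suc p) = sym (trans (/-* x 1 0 p) (/-cross (x ℕ.* 1) x (1 ℕ.* suc p) (suc p) (arithmetic x (suc p))))
      where
      arithmetic : ∀ x p → x ℕ.* 1 ℕ.* p ≡ x ℕ.* (1 ℕ.* p)
      arithmetic = solve-∀

  absorb : ∀ n x → ι (suc n) * (ι x * invFact (suc n)) ≡ ι x * invFact n
  absorb n x = begin
    ι (suc n) * (ι x * invFact (suc n))
      ≡⟨ cong (ι (suc n) *_) (sym (/!-ι x (suc n))) ⟩
    ι (suc n) * (+ x / (suc n) !) {{suc n !≢0}}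
      ≡⟨ cancel (n !) {{n !≢0}} {{suc n !≢0}} ⟩
    (+ x / n !) {{n !≢0}}
      ≡⟨ /!-ι x n ⟩
    ι x * invFact n ∎
    where
    open ≡-Reasoning
    cancel : ∀ f .{{_ : NonZero f}} .{{_ : NonZero (suc n ℕ.* f)}} → ι (suc n) * (+ x / (suc n ℕ.* f)) ≡ + x / f
    cancel (suc f) = trans (/-* (suc n) x 0 (f ℕ.+ n ℕ.* suc f))
                           (/-cross (suc n ℕ.* x) x (1 ℕ.* (suc n ℕ.* suc f)) (suc f) (arithmetic (suc f) n x))
      where
      arithmetic : ∀ f n x → suc n ℕ.* x ℕ.* f ≡ x ℕ.* (1 ℕ.* (f ℕ.+ n ℕ.* f))
      arithmetic = solve-∀

  IsEGF : FPS → (ℕ → Coeff) → Set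
  IsEGF S F = ∀ n k a b → S n k a b ≡ ι (F n k a b) * invFact n

  G-isEGF : IsEGF G ACount
  G-isEGF n k a b = /!-ι (ACount n k a b) n

  zero-coefficient : ∀ n → 0ℚ ≡ ι 0 * invFact n
  zero-coefficient n = sym (*-zeroˡ (invFact n))

  mulX-isEGF : ∀ {S F} → IsEGF S F → IsEGF (mulX S) (λ n k a b → prev k (λ i → F n i a b))
  mulX-isEGF e n zero    a b = zero-coefficient n
  mulX-isEGF e n (suc k) a b = e n k a b

  mulU-isEGF : ∀ {S F} → IsEGF S F → IsEGF (mulU S) (λ n k a b → prev a (λ j → F n k j b))
  mulU-isEGF e n k zero    b = zero-coefficient n
  mulU-isEGF e n k (suc a) b = e n k a b

  mulD-isEGF : ∀ {S F} → IsEGF S F → IsEGF (mulD S) (λ n k a b → prev b (λ j → F n k a j))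
  mulD-isEGF e n k a zero    = zero-coefficient n
  mulD-isEGF e n k a (suc b) = e n k a b

  x∂x-isEGF : ∀ {S F} → IsEGF S F → IsEGF (mulX (∂x S)) (λ n k a b → k ℕ.* F n k a b)
  x∂x-isEGF e n zero    a b = zero-coefficient n
  x∂x-isEGF {F = F} e n (suc k) a b =
    trans (cong (ι (suc k) *_) (e n (suc k) a b)) (ι-*-assoc (suc k) (F n (suc k) a b) (invFact n))

  -- ∂/∂t shifts n; the factor n + 1 is absorbed by the normalisation 1/(n + 1)!.
  ∂t-isEGF : ∀ {S F} → IsEGF S F → IsEGF (∂t S) (λ n → F (suc n))
  ∂t-isEGF {F = F} e n k a b = trans (cong (ι (suc n) *_) (e (suc n) k a b)) (absorb n (F (suc n) k a b))

  -- Multiplication by t shifts n back; in the normalisation it multiplies by n.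
  mulT-isEGF : ∀ {S} (H : ℕ → Coeff) → IsEGF S (λ n → H (suc n)) →
    IsEGF (mulT S) (λ n k a b → n ℕ.* H n k a b)
  mulT-isEGF H e zero    k a b = zero-coefficient 0
  mulT-isEGF H e (suc n) k a b =
    trans (e n k a b) (trans (sym (absorb n (H (suc n) k a b)))
                             (ι-*-assoc (suc n) (H (suc n) k a b) (invFact (suc n))))

  -- The recurrence embedded in ℚ, with each term split as the equation splits it.
  recurrence-ℚ : ∀ {F} → Recurrence F → ∀ n k a b →
    let P₁ = prev k (λ i → F n i a b)
        P₂ = prev a (λ j → prev k (λ i → F n i j b))
        P₃ = prev b (λ j → F n k a j) in
    ι (F (suc n) k a b) + ι (x²∂x (F n) k a b)
      ≡ ι (F n k a b) + ι (k ℕ.* F n k a b) + (ι (n ℕ.* P₁) + ι (n ℕ.* P₂) + ι (n ℕ.* P₃))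
  recurrence-ℚ {F} rec n k a b = begin
    ι (F (suc n) k a b) + ι (x²∂x (F n) k a b)
      ≡⟨ sym (ι-+ (F (suc n) k a b) (x²∂x (F n) k a b)) ⟩
    ι (F (suc n) k a b ℕ.+ x²∂x (F n) k a b)
      ≡⟨ cong ι (rec n k a b) ⟩
    ι (suc k ℕ.* F n k a b ℕ.+ n ℕ.* (P₁ ℕ.+ P₂ ℕ.+ P₃))
      ≡⟨ cong (λ m → ι (suc k ℕ.* F n k a b ℕ.+ m)) (distribute n P₁ P₂ P₃) ⟩
    ι (suc k ℕ.* F n k a b ℕ.+ (n ℕ.* P₁ ℕ.+ n ℕ.* P₂ ℕ.+ n ℕ.* P₃))
      ≡⟨ ι-+ (suc k ℕ.* F n k a b) (n ℕ.* P₁ ℕ.+ n ℕ.* P₂ ℕ.+ n ℕ.* P₃) ⟩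
    ι (F n k a b ℕ.+ k ℕ.* F n k a b) + ι (n ℕ.* P₁ ℕ.+ n ℕ.* P₂ ℕ.+ n ℕ.* P₃)
      ≡⟨ cong₂ _+_ (ι-+ (F n k a b) (k ℕ.* F n k a b))
                   (trans (ι-+ (n ℕ.* P₁ ℕ.+ n ℕ.* P₂) (n ℕ.* P₃))
                          (cong (_+ ι (n ℕ.* P₃)) (ι-+ (n ℕ.* P₁) (n ℕ.* P₂)))) ⟩
    ι (F n k a b) + ι (k ℕ.* F n k a b) + (ι (n ℕ.* P₁) + ι (n ℕ.* P₂) + ι (n ℕ.* P₃)) ∎
    where
    open ≡-Reasoning
    P₁ P₂ P₃ : ℕ
    P₁ = prev k (λ i → F n i a b)
    P₂ = prev a (λ j → prev k (λ i → F n i j b))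
    P₃ = prev b (λ j → F n k a j)
    distribute : ∀ n p q r → n ℕ.* (p ℕ.+ q ℕ.+ r) ≡ n ℕ.* p ℕ.+ n ℕ.* q ℕ.+ n ℕ.* r
    distribute = solve-∀

  balance : ∀ f kf x f₁ p₁ p₂ p₃ D → f₁ + x ≡ f + kf + (p₁ + p₂ + p₃) →
    f * D ≡ - (kf * D + - (x * D)) + (f₁ * D + - (p₁ * D + p₂ * D + p₃ * D))
  balance f kf x f₁ p₁ p₂ p₃ D eq = begin
    f * D
      ≡⟨ expand f kf x p₁ p₂ p₃ D ⟩
    - (kf * D + - (x * D)) + ((f + kf + (p₁ + p₂ + p₃) + - x) * D + - (p₁ * D + p₂ * D + p₃ * D))
      ≡⟨ cong (λ t → - (kf * D + - (x * D)) + ((t + - x) * D + - (p₁ * D + p₂ * D + p₃ * D))) (sym eq) ⟩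
    - (kf * D + - (x * D)) + ((f₁ + x + - x) * D + - (p₁ * D + p₂ * D + p₃ * D))
      ≡⟨ cong (λ t → - (kf * D + - (x * D)) + (t * D + - (p₁ * D + p₂ * D + p₃ * D))) (cancel f₁ x) ⟩
    - (kf * D + - (x * D)) + (f₁ * D + - (p₁ * D + p₂ * D + p₃ * D)) ∎
    where
    open ≡-Reasoning
    open +-*-Solver
    expand : ∀ f kf x p₁ p₂ p₃ D →
      f * D ≡ - (kf * D + - (x * D)) + ((f + kf + (p₁ + p₂ + p₃) + - x) * D + - (p₁ * D + p₂ * D + p₃ * D))
    expand = solve 7 (λ f kf x p₁ p₂ p₃ D →
      f :* D := :- (kf :* D :+ :- (x :* D))
                :+ ((f :+ kf :+ (p₁ :+ p₂ :+ p₃) :+ :- x) :* D :+ :- (p₁ :* D :+ p₂ :* D :+ p₃ :* D))) refl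
    cancel : ∀ y x → y + x + - x ≡ y
    cancel = solve 2 (λ y x → y :+ x :+ :- x := y) refl

  recurrence⇒equation : ∀ {S F} → IsEGF S F → Recurrence F → ∀ n k a b → S n k a b ≡ RHS S n k a b
  recurrence⇒equation {S} {F} e rec n k a b = begin
    S n k a b
      ≡⟨ e n k a b ⟩
    ι (F n k a b) * D
      ≡⟨ balance (ι (F n k a b)) (ι (k ℕ.* F n k a b)) (ι (x²∂x (F n) k a b)) (ι (F (suc n) k a b))
                 (ι (n ℕ.* P₁)) (ι (n ℕ.* P₂)) (ι (n ℕ.* P₃)) D (recurrence-ℚ rec n k a b) ⟩
    - (ι (k ℕ.* F n k a b) * D + - (ι (x²∂x (F n) k a b) * D))
      + (ι (F (suc n) k a b) * D + - (ι (n ℕ.* P₁) * D + ι (n ℕ.* P₂) * D + ι (n ℕ.* P₃) * D))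
      ≡⟨ sym (cong₂ _+_ (cong -_ (cong₂ _+_ (x∂x n k a b) (cong -_ (xx∂x n k a b))))
                        (cong₂ _+_ (dt n k a b) (cong -_ (cong₂ _+_ (cong₂ _+_ (tx∂t n k a b) (tux∂t n k a b)) (td∂t n k a b))))) ⟩
    RHS S n k a b ∎
    where
    open ≡-Reasoning
    D : ℚ
    D = invFact n
    P₁ P₂ P₃ : ℕ
    P₁ = prev k (λ i → F n i a b)
    P₂ = prev a (λ j → prev k (λ i → F n i j b))
    P₃ = prev b (λ j → F n k a j)
    x∂x : IsEGF (mulX (∂x S)) (λ n k a b → k ℕ.* F n k a b)
    x∂x = x∂x-isEGF {F = F} e
    xx∂x : IsEGF (mulX (mulX (∂x S))) (λ n → x²∂x (F n))
    xx∂x = mulX-isEGF {F = λ n k a b → k ℕ.* F n k a b} x∂x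
    dt : IsEGF (∂t S) (λ n → F (suc n))
    dt = ∂t-isEGF {F = F} e
    x∂t : IsEGF (mulX (∂t S)) (λ n k a b → prev k (λ i → F (suc n) i a b))
    x∂t = mulX-isEGF {F = λ n → F (suc n)} dt
    tx∂t : IsEGF (mulT (mulX (∂t S))) (λ n k a b → n ℕ.* prev k (λ i → F n i a b))
    tx∂t = mulT-isEGF (λ n k a b → prev k (λ i → F n i a b)) x∂t
    tux∂t : IsEGF (mulT (mulU (mulX (∂t S)))) (λ n k a b → n ℕ.* prev a (λ j → prev k (λ i → F n i j b)))
    tux∂t = mulT-isEGF (λ n k a b → prev a (λ j → prev k (λ i → F n i j b)))
                       (mulU-isEGF {F = λ n k a b → prev k (λ i → F (suc n) i a b)} x∂t)
    td∂t : IsEGF (mulT (mulD (∂t S))) (λ n k a b → n ℕ.* prev b (λ j → F n k a j))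
    td∂t = mulT-isEGF (λ n k a b → prev b (λ j → F n k a j)) (mulD-isEGF {F = λ n → F (suc n)} dt)

mainTheorem10 : ∀ (n k a b : ℕ) → G n k a b ≡ RHS G n k a b
mainTheorem10 = ExponentialGF.recurrence⇒equation ExponentialGF.G-isEGF GeneralizedPermutations.ACount-recurrence
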